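{- Let $T$ be a tree with $n\ge1$ vertices, let $t\ge1$ be an integer, and let $c$ be a $(t+1)$-dilated self-reachable configuration on $T$ with $\ell$ chips. Then for every integer $L$ with $n-1\le L\le \ell-t(n-1)$ there exists a self-reachable configuration $s$ on $T$ with exactly $L$ chips such that $c-s$ is $t$-dilated on $T$.
   Context: Label the vertices $v_1,\dots,v_n$. A chip configuration on $T$ is a vector $c\in\mathbb{Z}_{\ge0}^n$ ($c_i$ chips on $v_i$); the number of chips on a subtree is the sum of entries over its vertices. A subtree is a nonempty connected subgraph. For $t\ge1$, a configuration is $t$-dilated on $T$ if it has at least $t(m-1)$ chips on every $m$-vertex subtree of $T$. The Laplacian $\Delta(T)$ has $\Delta_{ii}=\deg(v_i)$, $\Delta_{ij}=-1$ if $v_iv_j$ is an edge, $0$ otherwise; firing $v_i$ from $c$ produces $c-\Delta(T)e_i$, legal if $c_i\ge\deg(v_i)$. A configuration is self-reachable on $T$ if some nonempty finite sequence of legal firings starting from it returns to it. (Known: self-reachable is equivalent to $1$-dilated.) -}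

module Defs where

open import Data.Nat using (ℕ; zero; suc; _+_; _*_; _∸_; _≤_)
open import Data.Fin using (Fin; zero; suc; _≟_)
open import Data.Bool using (Bool; true; false; if_then_else_)
open import Data.List using (List; []; _∷_)
open import Data.Product using (Σ; ∃; _×_; _,_)
open import Relation.Nullary using (does)
open import Relation.Binary.PropositionalEquality using (_≡_)

sumF : ∀ {n} → (Fin n → ℕ) → ℕ
sumF {zero}  f = 0
sumF {suc n} f = f zero + sumF (λ i → f (suc i))

Graph : ℕ → Set
Graph n = Fin n → Fin n → Bool

Config : ℕ → Set
Config n = Fin n → ℕ

VSet : ℕ → Set
VSet n = Fin n → Bool

deg : ∀ {n} → Graph n → Fin n → ℕ
deg adj i = sumF (λ j → if adj i j then 1 else 0)

data Walk {n} (adj : Graph n) (S : VSet n) : Fin n → Fin n → Set where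
  here : ∀ {u} → S u ≡ true → Walk adj S u u
  step : ∀ {u w v} → S u ≡ true → adj u w ≡ true → Walk adj S w v → Walk adj S u v

full : ∀ {n} → VSet n
full _ = true

-- T is a tree: simple (symmetric, loopless), connected, with n-1 edges
-- (sum of degrees = 2(n-1)).
record IsTree {n} (adj : Graph n) : Set where
  field
    symm      : ∀ i j → adj i j ≡ adj j i
    irrefl    : ∀ i → adj i i ≡ false
    connected : ∀ u v → Walk adj full u v
    edges     : sumF (deg adj) ≡ 2 * (n ∸ 1)

record IsSubtree {n} (adj : Graph n) (S : VSet n) : Set where
  field
    nonempty  : ∃ λ i → S i ≡ true
    connected : ∀ u v → S u ≡ true → S v ≡ true → Walk adj S u v

chipsOn : ∀ {n} → Config n → VSet n → ℕ
chipsOn c S = sumF (λ i → if S i then c i else 0)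

size : ∀ {n} → VSet n → ℕ
size S = sumF (λ i → if S i then 1 else 0)

Dilated : ∀ {n} → Graph n → ℕ → Config n → Set
Dilated adj t c = ∀ S → IsSubtree adj S → t * (size S ∸ 1) ≤ chipsOn c S

-- Firing vertex i: c - Δ e_i (used only when legal, c i ≥ deg i).
fire : ∀ {n} → Graph n → Config n → Fin n → Config n
fire adj c i j =
  if does (i ≟ j) then c j ∸ deg adj i
  else (if adj i j then suc (c j) else c j)

data Reaches {n} (adj : Graph n) : Config n → List (Fin n) → Config n → Set where
  done : ∀ {c d} → (∀ j → c j ≡ d j) → Reaches adj c [] d
  fires : ∀ {c i σ d} → deg adj i ≤ c i → Reaches adj (fire adj c i) σ d →
          Reaches adj c (i ∷ σ) d

SelfReachable : ∀ {n} → Graph n → Config n → Set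
SelfReachable adj c = Σ (Fin _) λ i → Σ (List (Fin _)) λ σ → Reaches adj c (i ∷ σ) c

module Submission where

-- Induction over subtrees A of T, removing a leaf v with neighbour u. Alongside s and the
-- remainder r = c - s we carry an order of A in which each vertex x has s x at least the number
-- of its neighbours placed after it: firing every vertex once in that order is then legal and
-- returns to s, so s is self-reachable. A subtree through v needs t more remainder chips than
-- its part in A - v, and these are found on u and v.
-- If c v > t, v gives between 1 and c v - t chips to s (as many as L allows), keeps at least t
-- in the remainder, and comes first in the order. Otherwise dilation on the edge uv gives
-- c u + c v ≥ t + 1; moving the chips of v onto u and removing t + 1 of them leaves a
-- (t+1)-dilated configuration on A - v. Its split extends to A by putting one removed chip into
-- s, on v (first in the order) or, if c v = 0, on u (v last), and the other t into the remainder.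

open import Defs
open import Data.Bool using (Bool; true; false; if_then_else_)
open import Data.Fin using (Fin; zero; suc; _≟_)
open import Data.List using (List; []; _∷_; _++_; map)
open import Data.List.Membership.Propositional using (_∈_)
open import Data.List.Properties using (map-++)
open import Data.List.Relation.Unary.Any using (here; there)
open import Data.Nat using (ℕ; zero; suc; _+_; _*_; _∸_; _≤_; _<_; z≤n; s≤s; s≤s⁻¹)
open import Data.Nat.ListAction using (sum)
open import Data.Nat.ListAction.Properties using (sum-++)
open import Data.Nat.Properties hiding (_≟_)
open import Data.Nat.Tactic.RingSolver using (solve-∀)
open import Data.Product using (Σ; ∃; ∃₂; _×_; _,_; proj₁; proj₂)
open import Data.Vec.Functional using (updateAt)
open import Data.Vec.Functional.Properties using (updateAt-updates; updateAt-minimal)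
open import Function using (const; _∘_)
open import Relation.Binary.PropositionalEquality
open import Relation.Nullary using (Dec; yes; no; does; contradiction)
open import Relation.Nullary.Decidable using (dec-true; dec-false)
open import Algebra.Properties.CommutativeSemigroup +-commutativeSemigroup
  using (interchange; x∙yz≈y∙xz; x∙yz≈yx∙z; xy∙z≈xz∙y; xy∙z≈y∙xz)

-- Chip counts on vertex sets

ind : Bool → ℕ
ind b = if b then 1 else 0

ind≤1 : ∀ b → ind b ≤ 1
ind≤1 true  = ≤-refl
ind≤1 false = z≤n

sumF-cong : ∀ {n} {f g : Fin n → ℕ} → (∀ i → f i ≡ g i) → sumF f ≡ sumF g
sumF-cong {zero}  f≗g = refl
sumF-cong {suc n} f≗g = cong₂ _+_ (f≗g zero) (sumF-cong (λ i → f≗g (suc i)))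

sumF-mono : ∀ {n} {f g : Fin n → ℕ} → (∀ i → f i ≤ g i) → sumF f ≤ sumF g
sumF-mono {zero}  f≤g = z≤n
sumF-mono {suc n} f≤g = +-mono-≤ (f≤g zero) (sumF-mono (λ i → f≤g (suc i)))

sumF-+ : ∀ {n} (f g : Fin n → ℕ) → sumF (λ i → f i + g i) ≡ sumF f + sumF g
sumF-+ {zero}  f g = refl
sumF-+ {suc n} f g =
  let f′ = λ i → f (suc i) ; g′ = λ i → g (suc i)
  in trans (cong (f zero + g zero +_) (sumF-+ f′ g′)) (interchange (f zero) (g zero) (sumF f′) (sumF g′))

sumF-zero : ∀ {n} {f : Fin n → ℕ} → (∀ i → f i ≡ 0) → sumF f ≡ 0
sumF-zero {zero}  f≗0 = refl
sumF-zero {suc n} f≗0 = cong₂ _+_ (f≗0 zero) (sumF-zero (λ i → f≗0 (suc i)))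

sumF-< : ∀ {n} (f g : Fin n → ℕ) → sumF f < sumF g → ∃ λ i → f i < g i
sumF-< {zero}  f g ()
sumF-< {suc n} f g Σf<Σg with f zero <? g zero
... | yes f0<g0 = zero , f0<g0
... | no  f0≮g0 =
  let i , fi<gi = sumF-< (λ i → f (suc i)) (λ i → g (suc i))
                    (+-cancelˡ-< (g zero) _ _ (≤-<-trans (+-monoˡ-≤ _ (≮⇒≥ f0≮g0)) Σf<Σg))
  in suc i , fi<gi

∈⇒≤sum-map : ∀ {a} {A : Set a} (f : A → ℕ) {x xs} → x ∈ xs → f x ≤ sum (map f xs)
∈⇒≤sum-map f (here refl)  = m≤m+n _ _
∈⇒≤sum-map f (there x∈xs) = ≤-trans (∈⇒≤sum-map f x∈xs) (m≤n+m _ _)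

_⊆_ : ∀ {n} → VSet n → VSet n → Set
S ⊆ T = ∀ i → S i ≡ true → T i ≡ true

del : ∀ {n} → VSet n → Fin n → VSet n
del S v i = if does (v ≟ i) then false else S i

add : ∀ {n} → VSet n → Fin n → VSet n
add S v i = if does (v ≟ i) then true else S i

single : ∀ {n} → Fin n → VSet n
single u i = does (u ≟ i)

module _ {n : ℕ} (S : VSet n) where

  del-self : ∀ v → del S v v ≡ false
  del-self v rewrite dec-true (v ≟ v) refl = refl

  del-⊆ : ∀ v → del S v ⊆ S
  del-⊆ v i i∈S-v with v ≟ i
  ... | no _ = i∈S-v

  del-≢ : ∀ {v i} → del S v i ≡ true → v ≢ i
  del-≢ {v} i∈S-v refl with trans (sym (del-self v)) i∈S-v
  ... | ()

  del-intro : ∀ {v i} → S i ≡ true → v ≢ i → del S v i ≡ true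
  del-intro {v} {i} i∈S v≢i rewrite dec-false (v ≟ i) v≢i = i∈S

  add-self : ∀ v → add S v v ≡ true
  add-self v rewrite dec-true (v ≟ v) refl = refl

  ⊆-add : ∀ v → S ⊆ add S v
  ⊆-add v i i∈S with v ≟ i
  ... | yes _ = refl
  ... | no  _ = i∈S

single-≡ : ∀ {n} {u x : Fin n} → single u x ≡ true → u ≡ x
single-≡ {u = u} {x} u∈ with u ≟ x
... | yes u≡x = u≡x
... | no  _   = contradiction u∈ λ ()

on-support : ∀ {R : ℕ → ℕ → Set} → R 0 0 → ∀ b {x y} → (b ≡ true → R x y) →
             R (if b then x else 0) (if b then y else 0)
on-support R00 true  Rxy = Rxy refl
on-support R00 false _   = R00

module _ {n : ℕ} where

  chipsOn-cong : ∀ {f g : Config n} S → (∀ i → S i ≡ true → f i ≡ g i) → chipsOn f S ≡ chipsOn g S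
  chipsOn-cong S f≗g = sumF-cong λ i → on-support {R = _≡_} refl (S i) (f≗g i)

  chipsOn-mono : ∀ {f g : Config n} S → (∀ i → S i ≡ true → f i ≤ g i) → chipsOn f S ≤ chipsOn g S
  chipsOn-mono S f≤g = sumF-mono λ i → on-support {R = _≤_} z≤n (S i) (f≤g i)

  chipsOn-vanish : ∀ {f : Config n} S → (∀ i → S i ≡ true → f i ≡ 0) → chipsOn f S ≡ 0
  chipsOn-vanish S f≗0 = sumF-zero λ i → on-support {R = λ x _ → x ≡ 0} refl (S i) {y = 0} (f≗0 i)

  chipsOn-⊆ : ∀ (f : Config n) {S T} → S ⊆ T → chipsOn f S ≤ chipsOn f T
  chipsOn-⊆ f {S} {T} S⊆T = sumF-mono pointwise
    where
      pointwise : ∀ i → (if S i then f i else 0) ≤ (if T i then f i else 0)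
      pointwise i with S i in i∈S
      ... | true rewrite S⊆T i i∈S = ≤-refl
      ... | false = z≤n

  chipsOn-+ : ∀ (f g : Config n) S → chipsOn (λ i → f i + g i) S ≡ chipsOn f S + chipsOn g S
  chipsOn-+ f g S = trans (sumF-cong pointwise) (sumF-+ (λ i → if S i then f i else 0) (λ i → if S i then g i else 0))
    where
      pointwise : ∀ i → (if S i then f i + g i else 0) ≡ (if S i then f i else 0) + (if S i then g i else 0)
      pointwise i with S i
      ... | true  = refl
      ... | false = refl

  chipsOn-< : ∀ (f g : Config n) S → chipsOn f S < chipsOn g S → ∃ λ i → S i ≡ true × f i < g i
  chipsOn-< f g S Σf<Σg with sumF-< _ _ Σf<Σg
  ... | i , fi<gi with S i in i∈S
  ...   | true = i , i∈S , fi<gi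

chipsOn-del : ∀ {n} (f : Config n) S x → S x ≡ true → chipsOn f S ≡ f x + chipsOn f (del S x)
chipsOn-del f S zero    x∈S rewrite x∈S = refl
chipsOn-del f S (suc x) x∈S =
  let head = if S zero then f zero else 0 ; f′ = λ i → f (suc i) ; S′ = λ i → S (suc i)
  in trans (cong (head +_) (chipsOn-del f′ S′ x x∈S)) (x∙yz≈y∙xz head (f (suc x)) (chipsOn f′ (del S′ x)))

chipsOn-add : ∀ {n} (f : Config n) S v → S v ≡ false → chipsOn f (add S v) ≡ f v + chipsOn f S
chipsOn-add f S zero    v∉S rewrite v∉S = refl
chipsOn-add f S (suc v) v∉S =
  let head = if S zero then f zero else 0 ; f′ = λ i → f (suc i) ; S′ = λ i → S (suc i)
  in trans (cong (head +_) (chipsOn-add f′ S′ v v∉S)) (x∙yz≈y∙xz head (f (suc v)) (chipsOn f′ S′))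

chipsOn-single : ∀ {n} (f : Config n) u → chipsOn f (single u) ≡ f u
chipsOn-single {suc n} f zero    = trans (cong (f zero +_) (sumF-zero {n} (λ _ → refl))) (+-identityʳ (f zero))
chipsOn-single {suc n} f (suc u) = chipsOn-single (λ i → f (suc i)) u

module _ {n : ℕ} where

  chipsOn-point : ∀ (f : Config n) S {x} → S x ≡ true → f x ≤ chipsOn f S
  chipsOn-point f S {x} x∈S = subst (f x ≤_) (sym (chipsOn-del f S x x∈S)) (m≤m+n (f x) _)

  chipsOn-updateAt : ∀ (f : Config n) {S x} (g : ℕ → ℕ) → S x ≡ true →
                     chipsOn (updateAt f x g) S ≡ g (f x) + chipsOn f (del S x)
  chipsOn-updateAt f {S} {x} g x∈S = begin
    chipsOn (updateAt f x g) S                            ≡⟨ chipsOn-del _ S x x∈S ⟩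
    updateAt f x g x + chipsOn (updateAt f x g) (del S x) ≡⟨ cong₂ _+_ (updateAt-updates x f)
                                                                        (chipsOn-cong (del S x) unchanged) ⟩
    g (f x) + chipsOn f (del S x)                         ∎
    where
      open ≡-Reasoning
      unchanged : ∀ i → del S x i ≡ true → updateAt f x g i ≡ f i
      unchanged i i∈S-x = updateAt-minimal i x f (del-≢ S i∈S-x ∘ sym)

  size-del : ∀ (S : VSet n) {v} → S v ≡ true → size S ≡ suc (size (del S v))
  size-del S {v} = chipsOn-del (const 1) S v

  chipsOn-const-2 : ∀ (S : VSet n) → chipsOn (const 2) S ≡ 2 * size S
  chipsOn-const-2 S = trans (chipsOn-+ (const 1) (const 1) S) (cong (size S +_) (sym (+-identityʳ (size S))))

  size>0⇒nonempty : ∀ (S : VSet n) → 0 < size S → ∃ λ i → S i ≡ true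
  size>0⇒nonempty S 0<|S| =
    let i , i∈S , _ = chipsOn-< (const 0) (const 1) S
                        (subst (_< size S) (sym (chipsOn-vanish {f = const 0} S (λ _ _ → refl))) 0<|S|)
    in i , i∈S

  size≡0⇒chipsOn≡0 : ∀ (f : Config n) {S} → size S ≡ 0 → chipsOn f S ≡ 0
  size≡0⇒chipsOn≡0 f {S} |S|≡0 =
    chipsOn-vanish S λ i i∈S → contradiction (subst (1 ≤_) |S|≡0 (chipsOn-point (const 1) S i∈S)) λ ()

  size≡1⇒singleton : ∀ (S : VSet n) → size S ≡ 1 → ∃ λ a → S a ≡ true × (∀ f → chipsOn f S ≡ f a)
  size≡1⇒singleton S |S|≡1 with a , a∈S ← size>0⇒nonempty S (subst (0 <_) (sym |S|≡1) (s≤s z≤n)) =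
    a , a∈S , λ f → trans (chipsOn-del f S a a∈S) (trans (cong (f a +_) (size≡0⇒chipsOn≡0 f |S-a|≡0))
                                                          (+-identityʳ (f a)))
    where
      |S-a|≡0 : size (del S a) ≡ 0
      |S-a|≡0 = suc-injective (trans (sym (size-del S a∈S)) |S|≡1)

size-full : ∀ {n} → size (full {n}) ≡ n
size-full {zero}  = refl
size-full {suc n} = cong suc (size-full {n})

-- Arithmetic of the leaf cases

rich-leaf-budget : ∀ {k L t cv C} → suc k ≤ L → L + t * suc k ≤ cv + C → suc t * k ≤ C → suc t ≤ cv →
                   ∃₂ λ a L' → ∃ λ rv → L ≡ a + L' × cv ≡ a + rv × 1 ≤ a × t ≤ rv ×
                                        k ≤ L' × L' + t * k ≤ C
rich-leaf-budget {k} {L} {t} {cv} {C} k<L budget k+tk≤C t<cv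
  with x , refl ← m≤n⇒∃[o]m+o≡n k<L | y , refl ← m≤n⇒∃[o]m+o≡n t<cv | x ≤? y
... | yes x≤y with z , refl ← m≤n⇒∃[o]m+o≡n x≤y =
  suc x , k , t + z , cong suc (+-comm k x) , cong suc (x∙yz≈y∙xz t x z) , s≤s z≤n , m≤m+n t z , ≤-refl , k+tk≤C
... | no  x≰y with z , refl ← m≤n⇒∃[o]m+o≡n (≰⇒> x≰y) =
  suc y , suc k + z , t , x∙yz≈y∙xz (suc k) (suc y) z , cong suc (+-comm t y) , s≤s z≤n , ≤-refl ,
  ≤-trans (m≤m+n k z) (n≤1+n _) ,
  +-cancelˡ-≤ (suc t + y) _ _
    (subst (_≤ suc t + y + C) (trans (cong (suc k + (suc y + z) +_) (*-suc t k)) (regroup k y z t (t * k))) budget)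
  where
    regroup : ∀ k y z t tk → suc k + (suc y + z) + (t + tk) ≡ suc t + y + (suc k + z + tk)
    regroup = solve-∀

poor-leaf-budget : ∀ {L k t cu cv e R} → cu + cv ≡ suc t + e → suc L + t * suc k ≤ cv + (cu + R) →
                   L + t * k ≤ e + R
poor-leaf-budget {L} {k} {t} {cu} {cv} {e} {R} cu+cv≡1+t+e budget = +-cancelˡ-≤ (suc t) _ _ (begin
  suc t + (L + t * k)   ≡⟨ regroup L t (t * k) ⟩
  suc L + (t + t * k)   ≡⟨ cong (suc L +_) (*-suc t k) ⟨
  suc L + t * suc k     ≤⟨ budget ⟩
  cv + (cu + R)         ≡⟨ x∙yz≈yx∙z cv cu R ⟩
  cu + cv + R           ≡⟨ cong (_+ R) cu+cv≡1+t+e ⟩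
  suc t + e + R         ≡⟨ +-assoc (suc t) e R ⟩
  suc t + (e + R)       ∎)
  where
    open ≤-Reasoning
    regroup : ∀ L t tk → suc t + (L + tk) ≡ suc L + (t + tk)
    regroup = solve-∀

empty-leaf-balance : ∀ {t cu s r} → cu + 0 ≡ suc t + (s + r) → cu ≡ s + 1 + (r + t)
empty-leaf-balance {t} {cu} {s} {r} eq = trans (sym (+-identityʳ cu)) (trans eq (regroup t s r))
  where
    regroup : ∀ t s r → suc t + (s + r) ≡ s + 1 + (r + t)
    regroup = solve-∀

small-leaf-balance : ∀ {t cu w s r} → cu + suc w ≡ suc t + (s + r) → w ≤ t →
                     ∃ λ ru → cu ≡ s + 0 + ru × r ≤ ru × r + t ≤ w + ru
small-leaf-balance {t} {cu} {w} {s} {r} eq w≤t with d , refl ← m≤n⇒∃[o]m+o≡n w≤t =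
  d + r , +-cancelʳ-≡ (suc w) cu _ (trans eq (regroup w d s r)) , m≤n+m r d , ≤-reflexive (regroup′ w d r)
  where
    regroup : ∀ w d s r → suc (w + d) + (s + r) ≡ s + 0 + (d + r) + suc w
    regroup = solve-∀
    regroup′ : ∀ w d r → r + (w + d) ≡ w + (d + r)
    regroup′ = solve-∀

module SimpleGraph {n : ℕ} (adj : Graph n) (symm : ∀ i j → adj i j ≡ adj j i)
                   (irrefl : ∀ i → adj i i ≡ false) where

  -- Leaves and subtrees

  Connected : VSet n → Set
  Connected S = ∀ x y → S x ≡ true → S y ≡ true → Walk adj S x y

  degIn : VSet n → Fin n → ℕ
  degIn A i = chipsOn (λ j → ind (adj i j)) A

  adj⇒≢ : ∀ {x y} → adj x y ≡ true → x ≢ y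
  adj⇒≢ {x} x~y refl with trans (sym (irrefl x)) x~y
  ... | ()

  walk-start : ∀ {S x y} → Walk adj S x y → S x ≡ true
  walk-start (here x∈S)     = x∈S
  walk-start (step x∈S _ _) = x∈S

  walk-mono : ∀ {S T x y} → S ⊆ T → Walk adj S x y → Walk adj T x y
  walk-mono S⊆T (here x∈S)          = here (S⊆T _ x∈S)
  walk-mono S⊆T (step x∈S x~w rest) = step (S⊆T _ x∈S) x~w (walk-mono S⊆T rest)

  walk-snoc : ∀ {S x y z} → Walk adj S x y → S z ≡ true → adj y z ≡ true → Walk adj S x z
  walk-snoc (here x∈S)          z∈S y~z = step x∈S y~z (here z∈S)
  walk-snoc (step x∈S x~w rest) z∈S y~z = step x∈S x~w (walk-snoc rest z∈S y~z)

  add-connected : ∀ {S u v} → Connected S → S u ≡ true → adj v u ≡ true → Connected (add S v)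
  add-connected {S} {u} {v} conn u∈S v~u x y x∈S+v y∈S+v with v ≟ x | v ≟ y
  ... | yes refl | yes refl = here (add-self S v)
  ... | yes refl | no  _    = step (add-self S v) v~u (walk-mono (⊆-add S v) (conn u y u∈S y∈S+v))
  ... | no  _    | yes refl =
    walk-snoc (walk-mono (⊆-add S v) (conn x u x∈S+v u∈S)) (add-self S v) (trans (symm u v) v~u)
  ... | no  _    | no  _    = walk-mono (⊆-add S v) (conn x y x∈S+v y∈S+v)

  single-subtree : ∀ u → IsSubtree adj (single u)
  single-subtree u = record { nonempty = u , dec-true (u ≟ u) refl ; connected = connected }
    where
      connected : Connected (single u)
      connected x y x∈ y∈ with refl ← single-≡ {u = u} {x} x∈ | refl ← single-≡ {u = u} {y} y∈ = here x∈

  degIn-del-self : ∀ A {v} → A v ≡ true → degIn (del A v) v ≡ degIn A v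
  degIn-del-self A {v} v∈A =
    sym (trans (chipsOn-del _ A v v∈A) (cong (λ b → ind b + degIn (del A v) v) (irrefl v)))

  degreeSum-del : ∀ {A v} → A v ≡ true →
                  chipsOn (degIn A) A ≡ degIn A v + (degIn A v + chipsOn (degIn (del A v)) (del A v))
  degreeSum-del {A} {v} v∈A = begin
    chipsOn (degIn A) A                                       ≡⟨ chipsOn-del _ A v v∈A ⟩
    degIn A v + chipsOn (degIn A) A'                          ≡⟨ cong (degIn A v +_) (chipsOn-cong A' split-v) ⟩
    degIn A v + chipsOn (λ i → ind (adj v i) + degIn A' i) A' ≡⟨ cong (degIn A v +_) (chipsOn-+ _ (degIn A') A') ⟩
    degIn A v + (degIn A' v + chipsOn (degIn A') A')          ≡⟨ cong (λ d → degIn A v + (d + chipsOn (degIn A') A'))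
                                                                      (degIn-del-self A v∈A) ⟩
    degIn A v + (degIn A v + chipsOn (degIn A') A')           ∎
    where
      open ≡-Reasoning
      A' = del A v
      split-v : ∀ i → A' i ≡ true → degIn A i ≡ ind (adj v i) + degIn A' i
      split-v i _ = trans (chipsOn-del _ A v v∈A) (cong (λ b → ind b + degIn A' i) (symm i v))

  record Leaf (A : VSet n) (v u : Fin n) : Set where
    field
      v∈A      : A v ≡ true
      u∈A      : A u ≡ true
      edge     : adj v u ≡ true
      degree≡1 : degIn A v ≡ 1

    v≢u : v ≢ u
    v≢u = adj⇒≢ edge

    unique : ∀ {w} → A w ≡ true → adj v w ≡ true → w ≡ u
    unique {w} w∈A v~w with w ≟ u
    ... | yes w≡u = w≡u
    ... | no  w≢u = contradiction (subst (2 ≤_) degree≡1 two≤deg) λ { (s≤s ()) }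
      where
        open ≤-Reasoning
        two≤deg : 2 ≤ degIn A v
        two≤deg = begin
          2                                  ≡⟨ cong₂ (λ a b → ind a + ind b) (sym edge) (sym v~w) ⟩
          ind (adj v u) + ind (adj v w)      ≤⟨ +-monoʳ-≤ _ (chipsOn-point _ (del A u) (del-intro A w∈A (w≢u ∘ sym))) ⟩
          ind (adj v u) + degIn (del A u) v  ≡⟨ chipsOn-del _ A u u∈A ⟨
          degIn A v                          ∎

    walk-avoid : ∀ {S} → S ⊆ A → ∀ {x y} → v ≢ x → v ≢ y → Walk adj S x y → Walk adj (del S v) x y
    walk-avoid {S} S⊆A v≢x v≢y (here x∈S) = here (del-intro S x∈S v≢x)
    walk-avoid {S} S⊆A v≢x v≢y (step {w = w} x∈S x~w rest) with v ≟ w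
    ... | no  v≢w  = step (del-intro S x∈S v≢x) x~w (walk-avoid S⊆A v≢w v≢y rest)
    ... | yes refl with rest
    ...   | here _ = contradiction refl v≢y
    ...   | step {w = w₂} _ v~w₂ rest₂ =
      subst (λ z → Walk adj (del S v) z _) w₂≡x
            (walk-avoid S⊆A (λ v≡w₂ → v≢x (trans v≡w₂ w₂≡x)) v≢y rest₂)
      where
        -- a walk can only enter and leave the leaf through its unique neighbour
        w₂≡x : w₂ ≡ _
        w₂≡x = trans (unique (S⊆A _ (walk-start rest₂)) v~w₂) (sym (unique (S⊆A _ x∈S) (trans (symm v _) x~w)))

    del-connected : ∀ {S} → S ⊆ A → Connected S → Connected (del S v)
    del-connected {S} S⊆A conn x y x∈S-v y∈S-v =
      walk-avoid S⊆A (del-≢ S x∈S-v) (del-≢ S y∈S-v) (conn x y (del-⊆ S v x x∈S-v) (del-⊆ S v y y∈S-v))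

    del-subtree : ∀ {S} → IsSubtree adj S → S ⊆ A → S v ≡ true → 0 < size (del S v) →
                  IsSubtree adj (del S v) × del S v u ≡ true
    del-subtree {S} subtree S⊆A v∈S 0<|S-v| =
      record { nonempty = u , u∈S-v ; connected = del-connected S⊆A conn } , u∈S-v
      where
        conn = IsSubtree.connected subtree
        reach-u : ∀ {w} → del S v w ≡ true → del S v u ≡ true
        reach-u {w} w∈S-v with conn v w v∈S (del-⊆ S v w w∈S-v)
        ... | here _ = contradiction refl (del-≢ S w∈S-v)
        ... | step _ v~x rest with unique (S⊆A _ (walk-start rest)) v~x
        ...   | refl = del-intro S (walk-start rest) v≢u
        u∈S-v : del S v u ≡ true
        u∈S-v = reach-u (proj₂ (size>0⇒nonempty (del S v) 0<|S-v|))

  leaf-at : ∀ {A v w} → degIn A v < 2 → v ≢ w → Walk adj A v w → ∃ λ u → Leaf A v u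
  leaf-at _ v≢w (here _) = contradiction refl v≢w
  leaf-at {A} {v} deg<2 _ (step {w = u} v∈A v~u rest) = u , record
    { v∈A = v∈A ; u∈A = walk-start rest ; edge = v~u
    ; degree≡1 = ≤-antisym (s≤s⁻¹ deg<2)
                   (subst (_≤ degIn A v) (cong ind v~u) (chipsOn-point _ A (walk-start rest))) }

  leaf-exists : ∀ {A} → Connected A → 1 < size A → chipsOn (degIn A) A < 2 * size A → ∃₂ λ v u → Leaf A v u
  leaf-exists {A} conn 1<|A| Σdeg<2|A|
    with v , v∈A , deg<2 ← chipsOn-< (degIn A) (const 2) A
                             (subst (chipsOn (degIn A) A <_) (sym (chipsOn-const-2 A)) Σdeg<2|A|)
    with w , w∈A-v ← size>0⇒nonempty (del A v) (s≤s⁻¹ (subst (1 <_) (size-del A v∈A) 1<|A|))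
    = v , leaf-at deg<2 (del-≢ A w∈A-v) (conn v w v∈A (del-⊆ A v w w∈A-v))

  record TreeOn (k : ℕ) (A : VSet n) : Set where
    field
      size≡     : size A ≡ suc k
      connected : Connected A
      degreeSum : chipsOn (degIn A) A ≡ 2 * k

    isSubtree : IsSubtree adj A
    isSubtree = record { nonempty = size>0⇒nonempty A (subst (0 <_) (sym size≡) (s≤s z≤n)) ; connected = connected }

  module _ {k : ℕ} {A : VSet n} (tree : TreeOn (suc k) A) where
    open TreeOn tree

    tree-leaf : ∃₂ λ v u → Leaf A v u
    tree-leaf = leaf-exists connected (subst (1 <_) (sym size≡) (s≤s (s≤s z≤n)))
                  (subst₂ _<_ (sym degreeSum) (cong (2 *_) (sym size≡)) (*-monoʳ-< 2 (n<1+n (suc k))))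

    del-leaf : ∀ {v u} → Leaf A v u → TreeOn k (del A v)
    del-leaf {v} leaf = record
      { size≡     = suc-injective (trans (sym (size-del A v∈A)) size≡)
      ; connected = del-connected (λ _ i∈A → i∈A) connected
      ; degreeSum = suc-injective (suc-injective (begin
          2 + rest                       ≡⟨ cong (λ d → d + (d + rest)) degree≡1 ⟨
          degIn A v + (degIn A v + rest) ≡⟨ degreeSum-del v∈A ⟨
          chipsOn (degIn A) A            ≡⟨ degreeSum ⟩
          2 * suc k                      ≡⟨ *-suc 2 k ⟩
          2 + 2 * k                      ∎)) }
      where
        open Leaf leaf
        open ≡-Reasoning
        rest = chipsOn (degIn (del A v)) (del A v)

  -- Firing schedules

  nbrsIn : Fin n → List (Fin n) → ℕ
  nbrsIn x ρ = sum (map (λ y → ind (adj x y)) ρ)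

  occ : Fin n → List (Fin n) → ℕ
  occ x ρ = sum (map (λ y → ind (does (x ≟ y))) ρ)

  -- π lists every vertex of A exactly once
  Enumerates : VSet n → List (Fin n) → Set
  Enumerates A π = ∀ f → sum (map f π) ≡ chipsOn f A

  -- When the vertices of the list are fired in order, x has already received a chip from each
  -- neighbour before it, so s x only has to pay for the neighbours after it.
  data Schedule (s : Config n) : List (Fin n) → Set where
    []  : Schedule s []
    _∷_ : ∀ {x ρ} → nbrsIn x ρ ≤ s x → Schedule s ρ → Schedule s (x ∷ ρ)

  ∈-enumerates : ∀ {A π x} → Enumerates A π → x ∈ π → A x ≡ true
  ∈-enumerates {A} {π} {x} enum x∈π with A x in x∈A
  ... | true  = refl
  ... | false =
    contradiction (subst (1 ≤_) Σout≡0 (subst (_≤ sum (map out π)) out-x (∈⇒≤sum-map out x∈π))) λ ()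
    where
      out : Fin n → ℕ
      out i = if A i then 0 else 1
      out-x : out x ≡ 1
      out-x rewrite x∈A = refl
      Σout≡0 : sum (map out π) ≡ 0
      Σout≡0 = trans (enum out) (chipsOn-vanish A λ i i∈A → cong (λ b → if b then 0 else 1) i∈A)

  schedule-mono : ∀ {s s' π} → (∀ {x} → x ∈ π → s x ≤ s' x) → Schedule s π → Schedule s' π
  schedule-mono s≤s' []          = []
  schedule-mono s≤s' (ok ∷ rest) = ≤-trans ok (s≤s' (here refl)) ∷ schedule-mono (s≤s' ∘ there) rest

  schedule-snoc : ∀ {s s' π v} → Schedule s π → (∀ {x} → x ∈ π → s x + ind (adj x v) ≤ s' x) →
                  Schedule s' (π ++ v ∷ [])
  schedule-snoc []                               _     = z≤n ∷ []
  schedule-snoc {s} {s'} {x ∷ ρ} {v} (ok ∷ rest) bound =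
    subst (_≤ s' x) (sym nbrs-snoc) (≤-trans (+-monoˡ-≤ _ ok) (bound (here refl)))
      ∷ schedule-snoc rest (bound ∘ there)
    where
      nbrs-snoc : nbrsIn x (ρ ++ v ∷ []) ≡ nbrsIn x ρ + ind (adj x v)
      nbrs-snoc = trans (cong sum (map-++ _ ρ (v ∷ [])))
                        (trans (sum-++ (map _ ρ) (ind (adj x v) ∷ [])) (cong (nbrsIn x ρ +_) (+-identityʳ _)))

  fire-self : ∀ (c : Config n) {x} → deg adj x ≤ c x → fire adj c x x + deg adj x ≡ c x
  fire-self c {x} legal rewrite dec-true (x ≟ x) refl = m∸n+n≡m legal

  fire-other : ∀ (c : Config n) {x j} ρ → x ≢ j → fire adj c x j + nbrsIn j ρ ≡ c j + nbrsIn j (x ∷ ρ)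
  fire-other c {x} {j} ρ x≢j rewrite dec-false (x ≟ j) x≢j | symm j x with adj x j
  ... | true  = sym (+-suc (c j) (nbrsIn j ρ))
  ... | false = refl

  -- d = c - Δ (occ ρ), the configuration reached from c by firing the vertices of ρ,
  -- stated without truncated subtraction
  record LeadsTo (c : Config n) (ρ : List (Fin n)) (d : Config n) : Set where
    constructor leadsTo
    field balance : ∀ j → d j + deg adj j * occ j ρ ≡ c j + nbrsIn j ρ

  leadsTo-head : ∀ {c d x ρ} → occ x ρ ≡ 0 → LeadsTo c (x ∷ ρ) d → d x + deg adj x ≡ c x + nbrsIn x ρ
  leadsTo-head {c} {d} {x} {ρ} x∉ρ (leadsTo balance) = begin
    d x + deg adj x                     ≡⟨ cong (d x +_) (*-identityʳ (deg adj x)) ⟨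
    d x + deg adj x * 1                 ≡⟨ cong (λ o → d x + deg adj x * (1 + o)) x∉ρ ⟨
    d x + deg adj x * (1 + occ x ρ)     ≡⟨ cong (λ b → d x + deg adj x * (ind b + occ x ρ)) (dec-true (x ≟ x) refl) ⟨
    d x + deg adj x * occ x (x ∷ ρ)     ≡⟨ balance x ⟩
    c x + (ind (adj x x) + nbrsIn x ρ)  ≡⟨ cong (λ b → c x + (ind b + nbrsIn x ρ)) (irrefl x) ⟩
    c x + nbrsIn x ρ                    ∎
    where open ≡-Reasoning

  leadsTo-tail : ∀ {c d x ρ} → occ x ρ ≡ 0 → deg adj x ≤ c x →
                 LeadsTo c (x ∷ ρ) d → LeadsTo (fire adj c x) ρ d
  leadsTo-tail {c} {d} {x} {ρ} x∉ρ legal leads@(leadsTo balance) = leadsTo λ j → at j (x ≟ j)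
    where
      open ≡-Reasoning
      at : ∀ j → Dec (x ≡ j) → d j + deg adj j * occ j ρ ≡ fire adj c x j + nbrsIn j ρ
      at _ (yes refl) = +-cancelʳ-≡ (deg adj x) _ _ (begin
        d x + deg adj x * occ x ρ + deg adj x    ≡⟨ cong (λ o → d x + deg adj x * o + deg adj x) x∉ρ ⟩
        d x + deg adj x * 0 + deg adj x          ≡⟨ cong (λ m → d x + m + deg adj x) (*-zeroʳ (deg adj x)) ⟩
        d x + 0 + deg adj x                      ≡⟨ cong (_+ deg adj x) (+-identityʳ (d x)) ⟩
        d x + deg adj x                          ≡⟨ leadsTo-head x∉ρ leads ⟩
        c x + nbrsIn x ρ                         ≡⟨ cong (_+ nbrsIn x ρ) (fire-self c legal) ⟨
        fire adj c x x + deg adj x + nbrsIn x ρ  ≡⟨ xy∙z≈xz∙y (fire adj c x x) (deg adj x) (nbrsIn x ρ) ⟩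
        fire adj c x x + nbrsIn x ρ + deg adj x  ∎)
      at j (no x≢j) = begin
        d j + deg adj j * occ j ρ                ≡⟨ cong (λ b → d j + deg adj j * (ind b + occ j ρ))
                                                         (dec-false (j ≟ x) (x≢j ∘ sym)) ⟨
        d j + deg adj j * occ j (x ∷ ρ)          ≡⟨ balance j ⟩
        c j + nbrsIn j (x ∷ ρ)                   ≡⟨ fire-other c ρ x≢j ⟨
        fire adj c x j + nbrsIn j ρ              ∎

  reaches-by-schedule : ∀ π {c d} → (∀ j → occ j π ≤ 1) → Schedule d π → LeadsTo c π d → Reaches adj c π d
  reaches-by-schedule [] {c} {d} _ [] (leadsTo balance) = done λ j → begin
    c j                  ≡⟨ +-identityʳ (c j) ⟨
    c j + 0              ≡⟨ balance j ⟨
    d j + deg adj j * 0  ≡⟨ cong (d j +_) (*-zeroʳ (deg adj j)) ⟩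
    d j + 0              ≡⟨ +-identityʳ (d j) ⟩
    d j                  ∎
    where open ≡-Reasoning
  reaches-by-schedule (x ∷ ρ) {c} {d} once (ok ∷ rest) leads =
    fires legal (reaches-by-schedule ρ (λ j → ≤-trans (m≤n+m _ _) (once j)) rest (leadsTo-tail x∉ρ legal leads))
    where
      x∉ρ : occ x ρ ≡ 0
      x∉ρ = n≤0⇒n≡0 (s≤s⁻¹ (subst (λ b → ind b + occ x ρ ≤ 1) (dec-true (x ≟ x) refl) (once x)))
      legal : deg adj x ≤ c x
      legal = +-cancelʳ-≤ (d x) (deg adj x) (c x) (begin
        deg adj x + d x   ≡⟨ +-comm (deg adj x) (d x) ⟩
        d x + deg adj x   ≡⟨ leadsTo-head x∉ρ leads ⟩
        c x + nbrsIn x ρ  ≤⟨ +-monoʳ-≤ (c x) ok ⟩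
        c x + d x         ∎)
        where open ≤-Reasoning

  schedule⇒selfReachable : ∀ {s π} → 1 ≤ n → Enumerates full π → Schedule s π → SelfReachable adj s
  schedule⇒selfReachable {π = []} 1≤n enum [] =
    contradiction (subst (1 ≤_) (sym (trans (enum (const 1)) size-full)) 1≤n) λ ()
  schedule⇒selfReachable {s} {π@(x ∷ σ)} _ enum schedule =
    x , σ , reaches-by-schedule π (≤-reflexive ∘ once) schedule (leadsTo λ j → cong (s j +_) (begin
      deg adj j * occ j π  ≡⟨ cong (deg adj j *_) (once j) ⟩
      deg adj j * 1        ≡⟨ *-identityʳ (deg adj j) ⟩
      deg adj j            ≡⟨ enum (λ y → ind (adj j y)) ⟨
      nbrsIn j π           ∎))
    where
      open ≡-Reasoning
      once : ∀ j → occ j π ≡ 1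
      once j = trans (enum _) (chipsOn-single (const 1) j)

  -- Dilation across a leaf

  DilatedIn : VSet n → ℕ → Config n → Set
  DilatedIn A m c = ∀ S → IsSubtree adj S → S ⊆ A → m * (size S ∸ 1) ≤ chipsOn c S

  dilatedIn-⊆ : ∀ {A B m c} → B ⊆ A → DilatedIn A m c → DilatedIn B m c
  dilatedIn-⊆ B⊆A dilated S subtree S⊆B = dilated S subtree (λ i i∈S → B⊆A i (S⊆B i i∈S))

  module _ {A : VSet n} {v u : Fin n} (leaf : Leaf A v u) where
    open Leaf leaf

    dilatedIn-attach : ∀ {m c S} → DilatedIn A m c → IsSubtree adj S → S ⊆ del A v → S u ≡ true →
                       m * size S ≤ c v + chipsOn c S
    dilatedIn-attach {m} {c} {S} dilated subtree S⊆A-v u∈S =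
      subst₂ (λ k x → m * (k ∸ 1) ≤ x) (chipsOn-add (const 1) S v v∉S) (chipsOn-add c S v v∉S)
        (dilated (add S v) subtree+v S+v⊆A)
      where
        v∉S : S v ≡ false
        v∉S with S v in v∈S
        ... | true  = contradiction refl (del-≢ A (S⊆A-v v v∈S))
        ... | false = refl
        subtree+v : IsSubtree adj (add S v)
        subtree+v = record { nonempty = v , add-self S v ; connected = add-connected (IsSubtree.connected subtree) u∈S edge }
        S+v⊆A : add S v ⊆ A
        S+v⊆A i i∈S+v with v ≟ i
        ... | yes refl = v∈A
        ... | no  _    = del-⊆ A v i (S⊆A-v i i∈S+v)

    dilatedIn-edge : ∀ {m c} → DilatedIn A m c → m ≤ c u + c v
    dilatedIn-edge {m} {c} dilated =
      subst₂ _≤_ (*-identityʳ m) (trans (cong (c v +_) (chipsOn-single c u)) (+-comm (c v) (c u)))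
        (subst (λ k → m * k ≤ c v + chipsOn c (single u)) (chipsOn-single (const 1) u)
          (dilatedIn-attach {m} dilated (single-subtree u) u⊆A-v (dec-true (u ≟ u) refl)))
      where
        u⊆A-v : single u ⊆ del A v
        u⊆A-v i u∈ with refl ← single-≡ {u = u} {i} u∈ = del-intro A u∈A v≢u

    dilatedIn-contract : ∀ {m c e} → DilatedIn A m c → c u + c v ≡ m + e →
                         DilatedIn (del A v) m (updateAt c u (const e))
    dilatedIn-contract {m} {c} {e} dilated cu+cv≡m+e S subtree S⊆A-v with S u in u∈S
    ... | false =
      subst (m * (size S ∸ 1) ≤_) (chipsOn-cong S unchanged)
            (dilated S subtree (λ i i∈S → del-⊆ A v i (S⊆A-v i i∈S)))
      where
        unchanged : ∀ i → S i ≡ true → c i ≡ updateAt c u (const e) i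
        unchanged i i∈S = sym (updateAt-minimal i u c λ { refl → contradiction (trans (sym i∈S) u∈S) λ () })
    ... | true = +-cancelˡ-≤ m _ _ (begin
        m + m * (size S ∸ 1)                    ≡⟨ *-suc m (size S ∸ 1) ⟨
        m * suc (size S ∸ 1)                    ≡⟨ cong (λ k → m * suc (k ∸ 1)) (size-del S u∈S) ⟩
        m * suc (size (del S u))                ≡⟨ cong (m *_) (size-del S u∈S) ⟨
        m * size S                              ≤⟨ dilatedIn-attach {m} dilated subtree S⊆A-v u∈S ⟩
        c v + chipsOn c S                       ≡⟨ cong (c v +_) (chipsOn-del c S u u∈S) ⟩
        c v + (c u + R)                         ≡⟨ x∙yz≈yx∙z (c v) (c u) R ⟩
        c u + c v + R                           ≡⟨ cong (_+ R) cu+cv≡m+e ⟩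
        m + e + R                               ≡⟨ +-assoc m e R ⟩
        m + (e + R)                             ≡⟨ cong (m +_) (chipsOn-updateAt c (const e) u∈S) ⟨
        m + chipsOn (updateAt c u (const e)) S  ∎)
      where
        open ≤-Reasoning
        R = chipsOn c (del S u)

    dilatedIn-extend : ∀ {t r' r} → DilatedIn (del A v) t r' → (∀ i → del A v i ≡ true → r' i ≤ r i) →
                       r' u + t ≤ r v + r u → DilatedIn A t r
    dilatedIn-extend {t} {r'} {r} dilated' r'≤r balance S subtree S⊆A with S v in v∈S
    ... | false = ≤-trans (dilated' S subtree S⊆A-v) (chipsOn-mono S λ i i∈S → r'≤r i (S⊆A-v i i∈S))
      where
        S⊆A-v : S ⊆ del A v
        S⊆A-v i i∈S = del-intro A {v} (S⊆A i i∈S) λ { refl → contradiction (trans (sym i∈S) v∈S) λ () }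
    ... | true = subst (λ k → t * (k ∸ 1) ≤ chipsOn r S) (sym (size-del S v∈S)) (bound (size S') refl)
      where
        S' = del S v
        S'⊆A-v : S' ⊆ del A v
        S'⊆A-v i i∈S' = del-intro A {v} (S⊆A i (del-⊆ S v i i∈S')) (del-≢ S i∈S')
        bound : ∀ k → size S' ≡ k → t * k ≤ chipsOn r S
        bound zero    _        = subst (_≤ chipsOn r S) (sym (*-zeroʳ t)) z≤n
        bound (suc k) |S'|≡1+k = begin
          t * suc k           ≡⟨ *-suc t k ⟩
          t + t * k           ≤⟨ +-monoʳ-≤ t (subst (λ j → t * (j ∸ 1) ≤ chipsOn r' S') |S'|≡1+k
                                                    (dilated' S' subtree' S'⊆A-v)) ⟩
          t + chipsOn r' S'   ≡⟨ cong (t +_) (chipsOn-del r' S' u u∈S') ⟩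
          t + (r' u + R')     ≡⟨ x∙yz≈yx∙z t (r' u) R' ⟩
          r' u + t + R'       ≤⟨ +-mono-≤ balance (chipsOn-mono (del S' u) λ i i∈S'-u →
                                                     r'≤r i (S'⊆A-v i (del-⊆ S' u i i∈S'-u))) ⟩
          r v + r u + R       ≡⟨ +-assoc (r v) (r u) R ⟩
          r v + (r u + R)     ≡⟨ cong (r v +_) (chipsOn-del r S' u u∈S') ⟨
          r v + chipsOn r S'  ≡⟨ chipsOn-del r S v v∈S ⟨
          chipsOn r S         ∎
          where
            open ≤-Reasoning
            split = del-subtree subtree S⊆A v∈S (subst (0 <_) (sym |S'|≡1+k) (s≤s z≤n))
            subtree' = proj₁ split
            u∈S' = proj₂ split
            R' = chipsOn r' (del S' u)
            R = chipsOn r (del S' u)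

  -- Splitting off a self-reachable configuration

  module Splitting (t : ℕ) where

    record Split (A : VSet n) (c : Config n) (L : ℕ) : Set where
      field
        s r        : Config n
        c≡s+r      : ∀ i → c i ≡ s i + r i
        s-total    : chipsOn s A ≡ L
        r-dilated  : DilatedIn A t r
        order      : List (Fin n)
        enumerates : Enumerates A order
        schedule   : Schedule s order

    split-singleton : ∀ {A c L} → size A ≡ 1 → L ≤ chipsOn c A → Split A c L
    split-singleton {A} {c} {L} |A|≡1 L≤cA
      with a , a∈A , chipsOn-A ← size≡1⇒singleton A |A|≡1
      with e , L+e≡ca ← m≤n⇒∃[o]m+o≡n (subst (L ≤_) (chipsOn-A c) L≤cA)
      = record
        { s = s ; r = r ; c≡s+r = c≡s+r
        ; s-total = trans (chipsOn-A s) (updateAt-updates a (const 0))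
        ; r-dilated = r-dilated
        ; order = a ∷ [] ; enumerates = λ f → trans (+-identityʳ (f a)) (sym (chipsOn-A f)) ; schedule = z≤n ∷ [] }
      where
        s r : Config n
        s = updateAt (const 0) a (const L)
        r = updateAt c a (const e)
        c≡s+r : ∀ i → c i ≡ s i + r i
        c≡s+r i with a ≟ i
        ... | yes refl = sym (trans (cong₂ _+_ (updateAt-updates a (const 0)) (updateAt-updates a c)) L+e≡ca)
        ... | no  a≢i  =
          sym (cong₂ _+_ (updateAt-minimal i a (const 0) (a≢i ∘ sym)) (updateAt-minimal i a c (a≢i ∘ sym)))
        r-dilated : DilatedIn A t r
        r-dilated S _ S⊆A = subst (_≤ chipsOn r S) (sym t*[|S|∸1]≡0) z≤n
          where
            t*[|S|∸1]≡0 : t * (size S ∸ 1) ≡ 0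
            t*[|S|∸1]≡0 = trans (cong (t *_) (m≤n⇒m∸n≡0 (subst (size S ≤_) |A|≡1 (chipsOn-⊆ (const 1) S⊆A))))
                                (*-zeroʳ t)

    -- Extends a split on A - v of a configuration c' that differs from c only at u: on A, the
    -- vertex v carries a chips of s and rv of the remainder, u carries s' u + b and ru.
    module _ {A : VSet n} {v u : Fin n} (leaf : Leaf A v u) {c c' : Config n} {L' : ℕ}
             (split' : Split (del A v) c' L') (c'≡c : ∀ {i} → u ≢ i → c' i ≡ c i) {a b rv ru : ℕ}
             (cv≡a+rv : c v ≡ a + rv) (cu≡s'u+b+ru : c u ≡ Split.s split' u + b + ru)
             (r'u≤ru : Split.r split' u ≤ ru) (balance : Split.r split' u + t ≤ rv + ru) where
      open Leaf leaf
      open Split split' renaming (s to s'; r to r'; c≡s+r to c'≡s'+r'; s-total to s'-total;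
                                  r-dilated to r'-dilated; order to order'; enumerates to enumerates';
                                  schedule to schedule')

      private
        A' = del A v

        by-vertex : ∀ {P : Fin n → Set} → P v → P u → (∀ {i} → v ≢ i → u ≢ i → P i) → ∀ i → P i
        by-vertex at-v at-u elsewhere i with v ≟ i | u ≟ i
        ... | yes refl | _        = at-v
        ... | no  _    | yes refl = at-u
        ... | no  v≢i  | no  u≢i  = elsewhere v≢i u≢i

        v∉A' : ∀ {X : Set} → A' v ≡ true → X
        v∉A' v∈A' = contradiction refl (del-≢ A v∈A')

        update₂ : Config n → (ℕ → ℕ) → ℕ → Config n
        update₂ f g x = updateAt (updateAt f u g) v (const x)

        update₂-v : ∀ f g x → update₂ f g x v ≡ x
        update₂-v f g x = updateAt-updates v (updateAt f u g)

        update₂-u : ∀ f g x → update₂ f g x u ≡ g (f u)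
        update₂-u f g x = trans (updateAt-minimal u v (updateAt f u g) v≢u′) (updateAt-updates u f)
          where v≢u′ = v≢u ∘ sym

        update₂-other : ∀ f g x {i} → v ≢ i → u ≢ i → update₂ f g x i ≡ f i
        update₂-other f g x {i} v≢i u≢i =
          trans (updateAt-minimal i v (updateAt f u g) (v≢i ∘ sym)) (updateAt-minimal i u f (u≢i ∘ sym))

        s r : Config n
        s = update₂ s' (_+ b) a
        r = update₂ r' (const ru) rv

        c≡s+r : ∀ i → c i ≡ s i + r i
        c≡s+r = by-vertex
          (trans cv≡a+rv (sym (cong₂ _+_ (update₂-v s' _ a) (update₂-v r' _ rv))))
          (trans cu≡s'u+b+ru (sym (cong₂ _+_ (update₂-u s' _ a) (update₂-u r' _ rv))))
          (λ {i} v≢i u≢i → trans (sym (c'≡c u≢i)) (trans (c'≡s'+r' i)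
                             (sym (cong₂ _+_ (update₂-other s' _ a v≢i u≢i) (update₂-other r' _ rv v≢i u≢i)))))

        s-total : chipsOn s A ≡ a + (b + L')
        s-total = begin
          chipsOn s A                                ≡⟨ chipsOn-updateAt (updateAt s' u (_+ b)) (const a) v∈A ⟩
          a + chipsOn (updateAt s' u (_+ b)) A'      ≡⟨ cong (a +_) (chipsOn-updateAt s' (_+ b) u∈A') ⟩
          a + (s' u + b + chipsOn s' (del A' u))     ≡⟨ cong (a +_) (xy∙z≈y∙xz (s' u) b _) ⟩
          a + (b + (s' u + chipsOn s' (del A' u)))   ≡⟨ cong (λ x → a + (b + x)) (chipsOn-del s' A' u u∈A') ⟨
          a + (b + chipsOn s' A')                    ≡⟨ cong (λ x → a + (b + x)) s'-total ⟩
          a + (b + L')                               ∎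
          where
            open ≡-Reasoning
            u∈A' = del-intro A u∈A v≢u

        r-dilated : DilatedIn A t r
        r-dilated = dilatedIn-extend leaf r'-dilated r'≤r
                      (subst₂ (λ x y → r' u + t ≤ x + y) (sym (update₂-v r' _ rv)) (sym (update₂-u r' _ rv)) balance)
          where
            r'≤r : ∀ i → A' i ≡ true → r' i ≤ r i
            r'≤r = by-vertex v∉A' (λ _ → subst (r' u ≤_) (sym (update₂-u r' _ rv)) r'u≤ru)
                             (λ v≢i u≢i _ → ≤-reflexive (sym (update₂-other r' _ rv v≢i u≢i)))

        split-with : ∀ order → Enumerates A order → Schedule s order → Split A c (a + (b + L'))
        split-with order enumerates schedule = record
          { s = s ; r = r ; c≡s+r = c≡s+r ; s-total = s-total ; r-dilated = r-dilated
          ; order = order ; enumerates = enumerates ; schedule = schedule }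

        member : ∀ {x} → x ∈ order' → A' x ≡ true
        member = ∈-enumerates enumerates'

      split-leaf-first : 1 ≤ a → Split A c (a + (b + L'))
      split-leaf-first 1≤a = split-with (v ∷ order')
        (λ f → trans (cong (f v +_) (enumerates' f)) (sym (chipsOn-del f A v v∈A)))
        (nbrs-v ∷ schedule-mono (λ x∈order' → s'≤s _ (member x∈order')) schedule')
        where
          nbrs-v : nbrsIn v order' ≤ s v
          nbrs-v = subst₂ _≤_ (sym (trans (enumerates' _) (trans (degIn-del-self A v∈A) degree≡1)))
                              (sym (update₂-v s' _ a)) 1≤a
          s'≤s : ∀ x → A' x ≡ true → s' x ≤ s x
          s'≤s = by-vertex v∉A' (λ _ → subst (s' u ≤_) (sym (update₂-u s' _ a)) (m≤m+n (s' u) b))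
                           (λ v≢i u≢i _ → ≤-reflexive (sym (update₂-other s' _ a v≢i u≢i)))

      split-leaf-last : 1 ≤ b → Split A c (a + (b + L'))
      split-leaf-last 1≤b = split-with (order' ++ v ∷ [])
        (λ f → begin
          sum (map f (order' ++ v ∷ []))  ≡⟨ cong sum (map-++ f order' (v ∷ [])) ⟩
          sum (map f order' ++ f v ∷ [])  ≡⟨ sum-++ (map f order') (f v ∷ []) ⟩
          sum (map f order') + (f v + 0)  ≡⟨ cong₂ _+_ (enumerates' f) (+-identityʳ (f v)) ⟩
          chipsOn f A' + f v              ≡⟨ +-comm _ (f v) ⟩
          f v + chipsOn f A'              ≡⟨ chipsOn-del f A v v∈A ⟨
          chipsOn f A                     ∎)
        (schedule-snoc schedule' λ x∈order' → bound _ (member x∈order'))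
        where
          open ≡-Reasoning
          not-adj : ∀ {x} → A' x ≡ true → u ≢ x → adj x v ≡ false
          not-adj {x} x∈A' u≢x with adj x v in x~v
          ... | true  = contradiction (sym (unique (del-⊆ A v x x∈A') (trans (symm v x) x~v))) u≢x
          ... | false = refl
          bound : ∀ x → A' x ≡ true → s' x + ind (adj x v) ≤ s x
          bound = by-vertex v∉A'
            (λ _ → subst (s' u + ind (adj u v) ≤_) (sym (update₂-u s' _ a))
                     (+-monoʳ-≤ (s' u) (≤-trans (ind≤1 (adj u v)) 1≤b)))
            (λ {x} v≢x u≢x x∈A' → subst₂ _≤_ (cong (λ e → s' x + ind e) (sym (not-adj x∈A' u≢x)))
                                             (sym (update₂-other s' _ a v≢x u≢x)) (≤-reflexive (+-identityʳ (s' x))))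

    Splittable : ℕ → Set
    Splittable k = ∀ {A} → TreeOn k A → ∀ c → DilatedIn A (suc t) c →
                   ∀ L → k ≤ L → L + t * k ≤ chipsOn c A → Split A c L

    module _ {k : ℕ} {A : VSet n} {v u : Fin n} (split-smaller : Splittable k) (tree : TreeOn (suc k) A)
             (leaf : Leaf A v u) {c : Config n} (dilated : DilatedIn A (suc t) c) where
      open Leaf leaf
      private
        A' = del A v
        tree' = del-leaf tree leaf
        cA≡cv+cA' : chipsOn c A ≡ c v + chipsOn c A'
        cA≡cv+cA' = chipsOn-del c A v v∈A
        u∈A' : A' u ≡ true
        u∈A' = del-intro A u∈A v≢u

      split-rich-leaf : suc t ≤ c v → ∀ {L} → suc k ≤ L → L + t * suc k ≤ chipsOn c A → Split A c L
      split-rich-leaf t<cv {L} k<L budget =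
        from-budget (rich-leaf-budget k<L (subst (_ ≤_) cA≡cv+cA' budget) dilated-A' t<cv)
        where
          dilated-A' : suc t * k ≤ chipsOn c A'
          dilated-A' = subst (λ m → suc t * (m ∸ 1) ≤ chipsOn c A') (TreeOn.size≡ tree')
                             (dilated A' (TreeOn.isSubtree tree') (del-⊆ A v))
          from-budget : (∃₂ λ a L' → ∃ λ rv → L ≡ a + L' × c v ≡ a + rv × 1 ≤ a × t ≤ rv × k ≤ L' ×
                                              L' + t * k ≤ chipsOn c A') →
                        Split A c L
          from-budget (a , L' , rv , L≡a+L' , cv≡a+rv , 1≤a , t≤rv , k≤L' , budget') =
            subst (Split A c) (sym L≡a+L')
              (split-leaf-first leaf split' (λ _ → refl) cv≡a+rv
                 (trans (c≡s+r u) (cong (_+ r' u) (sym (+-identityʳ (s' u))))) ≤-refl (subst (_≤ rv + r' u) (+-comm t (r' u)) (+-monoˡ-≤ (r' u) t≤rv)) 1≤a)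
            where
              split' = split-smaller tree' c (dilatedIn-⊆ {m = suc t} (del-⊆ A v) dilated) L' k≤L' budget'
              open Split split' renaming (s to s'; r to r')

      split-poor-leaf : c v ≤ t → ∀ {L} → suc k ≤ L → L + t * suc k ≤ chipsOn c A → Split A c L
      split-poor-leaf cv≤t {suc L'} (s≤s k≤L') budget
        with e , 1+t+e≡cu+cv ← m≤n⇒∃[o]m+o≡n (dilatedIn-edge leaf {suc t} dilated)
        = by-load (c v) refl
        where
          c' = updateAt c u (const e)
          c'≡c : ∀ {i} → u ≢ i → c' i ≡ c i
          c'≡c {i} u≢i = updateAt-minimal i u c (u≢i ∘ sym)
          budget' : L' + t * k ≤ chipsOn c' A'
          budget' = subst (L' + t * k ≤_) (sym (chipsOn-updateAt c (const e) u∈A'))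
                      (poor-leaf-budget {L'} {k} {t} {c u} {c v} {e} {chipsOn c (del A' u)} (sym 1+t+e≡cu+cv)
                        (subst (suc L' + t * suc k ≤_)
                               (trans cA≡cv+cA' (cong (c v +_) (chipsOn-del c A' u u∈A'))) budget))
          split' = split-smaller tree' c' (dilatedIn-contract leaf {suc t} dilated (sym 1+t+e≡cu+cv)) L' k≤L' budget'
          open Split split' renaming (s to s'; r to r')
          load : ∀ {w} → c v ≡ w → c u + w ≡ suc t + (s' u + r' u)
          load refl = trans (sym 1+t+e≡cu+cv) (cong (suc t +_) (trans (sym (updateAt-updates u c)) (c≡s+r u)))
          by-load : ∀ w → c v ≡ w → Split A c (suc L')
          by-load zero cv≡0 =
            split-leaf-last leaf split' c'≡c {a = 0} {b = 1} {rv = 0} cv≡0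
              (empty-leaf-balance {t} {c u} {s' u} {r' u} (load cv≡0)) (m≤m+n (r' u) t) ≤-refl (s≤s z≤n)
          by-load (suc w) cv≡1+w
            with ru , cu≡ , r'u≤ru , balance ←
                   small-leaf-balance (load cv≡1+w) (≤-trans (n≤1+n w) (subst (_≤ t) cv≡1+w cv≤t))
            = split-leaf-first leaf split' c'≡c {a = 1} {b = 0} {rv = w} cv≡1+w cu≡ r'u≤ru balance (s≤s z≤n)

    split : ∀ k → Splittable k
    split zero {A} tree c _ L _ budget =
      split-singleton (TreeOn.size≡ tree)
        (subst (_≤ chipsOn c A) (trans (cong (L +_) (*-zeroʳ t)) (+-identityʳ L)) budget)
    split (suc k) tree c dilated L k<L budget with tree-leaf tree
    ... | v , u , leaf with suc t ≤? c v
    ...   | yes t<cv = split-rich-leaf (split k) tree leaf dilated t<cv k<L budget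
    ...   | no  t≮cv = split-poor-leaf (split k) tree leaf dilated (s≤s⁻¹ (≰⇒> t≮cv)) k<L budget

lemma4p8 : (n : ℕ) → (adj : Graph n) → 1 ≤ n → IsTree adj →
    (t : ℕ) → 1 ≤ t → (c : Config n) →
    Dilated adj (suc t) c → SelfReachable adj c →
    (L : ℕ) → n ∸ 1 ≤ L → L + t * (n ∸ 1) ≤ sumF c →
    Σ (Config n) λ s → SelfReachable adj s × sumF s ≡ L ×
      (∀ i → s i ≤ c i) × Dilated adj t (λ i → c i ∸ s i)
lemma4p8 zero    _   () _ _ _ _ _ _ _ _ _
lemma4p8 (suc k) adj _ tree t _ c dilated _ L k≤L budget =
  s , schedule⇒selfReachable (s≤s z≤n) enumerates schedule , s-total , s≤c , rest-dilated
  where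
    open SimpleGraph adj (IsTree.symm tree) (IsTree.irrefl tree)
    open Splitting t
    whole-tree : TreeOn k full
    whole-tree = record { size≡ = size-full ; connected = λ x y _ _ → IsTree.connected tree x y
                        ; degreeSum = IsTree.edges tree }
    open Split (split k whole-tree c (λ S subtree _ → dilated S subtree) L k≤L budget)
    s≤c : ∀ i → s i ≤ c i
    s≤c i = subst (s i ≤_) (sym (c≡s+r i)) (m≤m+n (s i) (r i))
    rest-dilated : Dilated adj t (λ i → c i ∸ s i)
    rest-dilated S subtree =
      subst (t * (size S ∸ 1) ≤_) (chipsOn-cong S c∸s≡r) (r-dilated S subtree (λ _ _ → refl))
      where
        c∸s≡r : ∀ i → S i ≡ true → r i ≡ c i ∸ s i
        c∸s≡r i _ = sym (trans (cong (_∸ s i) (c≡s+r i)) (m+n∸m≡n (s i) (r i)))
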